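{- Let $G=(V,E)$ be a DAG with $|V|=n$ and maximum out-degree $d_{out}$. Then there exists an $r^{(top)}$-visit $\psi$ of $G$ such that: (a) if $d_{out}=0$, then $b_{r^{(top)}}(\psi)=0$; (b) if $d_{out}=1$, then $b_{r^{(top)}}(\psi)=1$; and (c) if $d_{out}\leq D$ for some $D\geq 2$, then $b_{r^{(top)}}(\psi)\leq \frac{D-1}{\log_2 D}\log_2 n+1$.
   Context: For a vertex $v$ of a finite DAG $G=(V,E)$, $\mathrm{pred}(v)=\{u : (u,v)\in E\}$ and $\mathrm{suc}(v)=\{u : (v,u)\in E\}$; the maximum out-degree is $\max_v|\mathrm{suc}(v)|$. A visit rule $r$ for $G$ assigns to each $v\in V$ a non-empty family $r(v)$ of subsets of $\mathrm{pred}(v)$, called enablers of $v$. An $r$-sequence is a sequence $\psi$ of distinct vertices such that for every $1\le i\le|\psi|$ the set of vertices of the prefix $\psi[1..i-1]$ contains some enabler $Q\in r(\psi[i])$. An $r$-visit is an $r$-sequence containing all $n$ vertices. The $r$-boundary of an $r$-sequence $\psi$ is $B_r(\psi)=\{v\in V\setminus\psi : \exists Q\neq\emptyset,\ Q\in r(v),\ Q\subseteq\psi\}$, and $b_r(\psi)=\max_{1\le i\le|\psi|}|B_r(\psi[1..i])|$. The topological rule is $r^{(top)}(v)=\{\mathrm{pred}(v)\}$ (so $r^{(top)}$-visits are exactly the topological orderings of $G$). -}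

module Defs where

open import Data.Bool using (Bool; true; false)
open import Data.Nat using (ℕ; zero; suc; _⊔_)
open import Data.Fin using (Fin; toℕ)
open import Data.Fin.Subset using (Subset; _⊆_; _∈_; Nonempty; ∣_∣; ⁅_⁆; _∪_; ⊥)
open import Data.Fin.Subset.Properties using (_∈?_; _⊆?_; nonempty?; ⊆-refl)
open import Data.Vec using (tabulate)
open import Data.List using (List; []; _∷_; [_]; length; take; lookup; foldr; map; applyUpTo)
open import Data.List.Relation.Unary.Any using (Any; any?; here)
open import Data.List.Relation.Unary.All using (All)
open import Data.List.Relation.Unary.Unique.Propositional using (Unique)
import Data.List.Membership.Propositional as LM
open import Data.Product using (_×_; Σ)
open import Relation.Nullary using (¬_; ¬?; Dec)
open import Relation.Nullary.Decidable using (⌊_⌋; _×-dec_)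
open import Relation.Binary.PropositionalEquality using (_≡_)

Graph : ℕ → Set
Graph n = Fin n → Fin n → Bool

data Path {n : ℕ} (E : Graph n) : Fin n → Fin n → Set where
  edge : ∀ {u v} → E u v ≡ true → Path E u v
  step : ∀ {u w v} → E u w ≡ true → Path E w v → Path E u v

Acyclic : ∀ {n} → Graph n → Set
Acyclic {n} E = (v : Fin n) → ¬ Path E v v

predSet : ∀ {n} → Graph n → Fin n → Subset n
predSet E v = tabulate (λ u → E u v)

sucSet : ∀ {n} → Graph n → Fin n → Subset n
sucSet E v = tabulate (λ u → E v u)

maxOutDeg : ∀ {n} → Graph n → ℕ
maxOutDeg {n} E = foldr _⊔_ 0 (map (λ v → ∣ sucSet E v ∣) (Data.List.allFin n))
  where import Data.List

record VisitRule {n : ℕ} (E : Graph n) : Set where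
  field
    enablers    : Fin n → List (Subset n)
    nonEmptyFam : (v : Fin n) → Σ (Subset n) (λ Q → Q LM.∈ enablers v)
    subPred     : (v : Fin n) → All (λ Q → Q ⊆ predSet E v) (enablers v)
open VisitRule public

rTop : ∀ {n} (E : Graph n) → VisitRule E
rTop E = record
  { enablers    = λ v → [ predSet E v ]
  ; nonEmptyFam = λ v → predSet E v Data.Product., here _≡_.refl
  ; subPred     = λ v → ⊆-refl All.∷ All.[]
  }
  where import Data.Product
        import Data.List.Relation.Unary.All as All

vset : ∀ {n} → List (Fin n) → Subset n
vset = foldr (λ v s → ⁅ v ⁆ ∪ s) ⊥

IsRSeq : ∀ {n} {E : Graph n} → VisitRule E → List (Fin n) → Set
IsRSeq r ψ =
  Unique ψ ×
  ((i : Fin (length ψ)) →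
     Any (λ Q → Q ⊆ vset (take (toℕ i) ψ)) (enablers r (lookup ψ i)))

IsRVisit : ∀ {n} {E : Graph n} → VisitRule E → List (Fin n) → Set
IsRVisit {n} r ψ = IsRSeq r ψ × ((v : Fin n) → v LM.∈ ψ)

boundary : ∀ {n} {E : Graph n} → VisitRule E → List (Fin n) → Subset n
boundary r ψ = tabulate λ v →
  ⌊ ¬? (v ∈? vset ψ) ×-dec
    any? (λ Q → nonempty? Q ×-dec (Q ⊆? vset ψ)) (enablers r v) ⌋

bnum : ∀ {n} {E : Graph n} → VisitRule E → List (Fin n) → ℕ
bnum r ψ =
  foldr _⊔_ 0 (applyUpTo (λ i → ∣ boundary r (take (suc i) ψ) ∣) (length ψ))

module Submission where

-- A phase started at a ready vertex c visits c and then, as long as some vertex has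
-- entered the boundary since the phase began, runs the shortest of the phases that could
-- be started at these new boundary vertices.  They are successors of c, so there are
-- k ≤ d of them; their candidate phases are pairwise disjoint (each consists of vertices
-- whose unvisited ancestors all descend from its start) and are all visited before the
-- phase ends.  So a phase of length s whose first sub-phase has length s′ has k s′ < s,
-- while the boundary exceeds its size at the start of the phase by at most k − 1 plus the
-- excess inside the sub-phase.  This recurrence solves to d^(x−1) ≤ s^(d−1), that is
-- x ≤ (d − 1) log_d s + 1, and to x ≤ d when d ≤ 1.  Between phases the boundary is empty,
-- and acyclicity provides a ready vertex to start the next phase.

open import Defs
open import Data.Bool using (Bool; true)
import Data.Bool as Bool
open import Data.Bool.Properties using (T-≡)
open import Data.Fin using (Fin; toℕ) renaming (zero to fzero; suc to fsuc)
open import Data.Fin.Properties using (_≟_; any?; all?; ¬∀⟶∃¬; toℕ<n)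
open import Data.Fin.Subset
  using (Subset; Nonempty; inside; outside; ∣_∣; ⁅_⁆; _∪_; _─_; _-_)
  renaming (_∈_ to _∈ₛ_; _∉_ to _∉ₛ_; _⊆_ to _⊆ₛ_)
import Data.Fin.Subset.Properties as SP
open import Data.Fin.Subset.Properties
  using ( p⊆q⇒∣p∣≤∣q∣; ∣p∣≤n; ∣⊥∣≡0; ∣⁅x⁆∣≡1; ∣p─q∣≤∣p∣; x∈p⇒∣p-x∣<∣p∣; Empty-unique; nonempty?
        ; x∈p∪q⁺; x∈p∪q⁻; x∈⁅x⁆; x∈⁅y⁆⇒x≡y; ∉⊥; p─q⊆p; x∈p∧x∉q⇒x∈p─q; x∈p∧x≢y⇒x∈p-y)
open import Data.List using (List; []; _∷_; _++_; [_]; length; take; lookup; map; concat; filter; foldr; applyUpTo; allFin)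
open import Data.List.Extrema.Nat using (argmin; f[argmin]≤f[xs])
open import Data.List.Properties
  using (++-assoc; ++-identityʳ; length-++; length-++-sucʳ; length-++-≤ʳ; length-++-≤ˡ; length-map; length-tabulate; foldr-preservesᵒ)
open import Data.List.Membership.Propositional using (_∈_; _∉_)
open import Data.List.Membership.Propositional.Properties
  using ( ∈-++⁻; ∈-++⁺ˡ; ∈-++⁺ʳ; ∈-∃++; ∈-allFin; ∈-concat⁻; ∈-filter⁺; ∈-filter⁻; ∈-length
        ; ∈-map⁺; ∈-map⁻; ∈-applyUpTo⁺; ∈-applyUpTo⁻; foldr-selective)
open import Data.List.Relation.Binary.Disjoint.Propositional using (Disjoint)
open import Data.List.Relation.Binary.Subset.Propositional using (_⊆_)
open import Data.List.Relation.Unary.All using (All; []; _∷_)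
import Data.List.Relation.Unary.All as All
open import Data.List.Relation.Unary.All.Properties using (All¬⇒¬Any; ¬Any⇒All¬) renaming (map⁺ to All-map⁺)
open import Data.List.Relation.Unary.AllPairs using (AllPairs)
import Data.List.Relation.Unary.AllPairs as AllPairs
open import Data.List.Relation.Unary.AllPairs.Properties using () renaming (map⁺ to AllPairs-map⁺; map⁻ to AllPairs-map⁻)
open import Data.List.Relation.Unary.Any using (here; there)
import Data.List.Relation.Unary.Any as Any
open import Data.List.Relation.Unary.Any.Properties using (lookup-index)
open import Data.List.Relation.Unary.Unique.Propositional using (Unique)
open import Data.List.Relation.Unary.Unique.Propositional.Properties using (concat⁺; filter⁺; allFin⁺)
open import Data.Nat using (ℕ; zero; suc; _+_; _*_; _∸_; _^_; _⊔_; _≤_; _<_; z≤n; s≤s; >-nonZero)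
open import Data.Nat.Properties hiding (_≟_)
open import Data.Nat.Solver using (module +-*-Solver)
open import Data.Product using (Σ; ∃-syntax; _×_; _,_; proj₁; proj₂)
open import Data.Sum using (_⊎_; inj₁; inj₂; [_,_]′)
open import Data.Vec using ([]; _∷_; tabulate)
import Data.Vec as Vec
open import Data.Vec.Properties using (lookup∘tabulate; []=⇒lookup; lookup⇒[]=)
open import Function using (_∘_; Equivalence)
open import Relation.Binary.Construct.Closure.ReflexiveTransitive using (Star; ε; _◅_; _◅◅_)
open import Relation.Binary.PropositionalEquality
  using (_≡_; _≢_; refl; sym; trans; cong; subst; ≢-sym; module ≡-Reasoning)
open import Relation.Nullary using (¬_; Dec; yes; no; ¬?; contradiction)
open import Relation.Nullary.Decidable using (⌊_⌋; _→-dec_; _×-dec_; toWitness; fromWitness)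

open +-*-Solver using (solve; _:+_; _:*_; _:=_; con)
open import Algebra.Properties.CommutativeSemigroup *-commutativeSemigroup using (interchange)

[1+m]^k≤[1+k]*m^k : ∀ m k → k ≤ m → suc m ^ k ≤ suc k * m ^ k
[1+m]^k≤[1+k]*m^k m zero    _     = ≤-refl
[1+m]^k≤[1+k]*m^k m (suc k) 1+k≤m = begin
  suc m * suc m ^ k                  ≤⟨ *-monoʳ-≤ (suc m) ([1+m]^k≤[1+k]*m^k m k (<⇒≤ 1+k≤m)) ⟩
  suc m * (suc k * m ^ k)            ≡⟨ expand m k (m ^ k) ⟩
  suc k * (m * m ^ k) + suc k * m ^ k ≤⟨ +-monoʳ-≤ (suc k * (m * m ^ k)) (*-monoˡ-≤ (m ^ k) 1+k≤m) ⟩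
  suc k * (m * m ^ k) + m * m ^ k    ≡⟨ +-comm (suc k * (m * m ^ k)) (m * m ^ k) ⟩
  suc (suc k) * (m * m ^ k)          ∎
  where
  open ≤-Reasoning
  expand : ∀ m k p → suc m * (suc k * p) ≡ suc k * (m * p) + suc k * p
  expand = solve 3 (λ m k p → (con 1 :+ m) :* ((con 1 :+ k) :* p)
                              := (con 1 :+ k) :* (m :* p) :+ (con 1 :+ k) :* p) refl

[1+k+t]^k≤[1+k]^[k+t] : ∀ k t → (suc k + t) ^ k ≤ suc k ^ (k + t)
[1+k+t]^k≤[1+k]^[k+t] k zero    rewrite +-identityʳ k = ≤-refl
[1+k+t]^k≤[1+k]^[k+t] k (suc t) = begin
  (suc k + suc t) ^ k         ≡⟨ cong (_^ k) (+-suc (suc k) t) ⟩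
  suc (suc k + t) ^ k         ≤⟨ [1+m]^k≤[1+k]*m^k (suc k + t) k (≤-trans (n≤1+n k) (m≤m+n (suc k) t)) ⟩
  suc k * (suc k + t) ^ k     ≤⟨ *-monoʳ-≤ (suc k) ([1+k+t]^k≤[1+k]^[k+t] k t) ⟩
  suc k * suc k ^ (k + t)     ≡⟨ cong (suc k ^_) (+-suc k t) ⟨
  suc k ^ (k + suc t)         ∎
  where open ≤-Reasoning

-- The integer form of log m / (m − 1) ≤ log k / (k − 1) for 1 < k ≤ m.
m^[k∸1]≤k^[m∸1] : ∀ {k m} → 1 ≤ k → k ≤ m → m ^ (k ∸ 1) ≤ k ^ (m ∸ 1)
m^[k∸1]≤k^[m∸1] {suc k} _ k≤m with t , refl ← m≤n⇒∃[o]m+o≡n k≤m = [1+k+t]^k≤[1+k]^[k+t] k t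

1≤m^n : ∀ {m} n → 1 ≤ m → 1 ≤ m ^ n
1≤m^n {m} n 1≤m = ≤-trans (≤-reflexive (sym (^-zeroˡ n))) (^-monoˡ-≤ n 1≤m)

m^[a+b∸1]≤m^a*m^[b∸1] : ∀ {m} a b → 1 ≤ m → m ^ (a + b ∸ 1) ≤ m ^ a * m ^ (b ∸ 1)
m^[a+b∸1]≤m^a*m^[b∸1] {m} a zero 1≤m = begin
  m ^ (a + 0 ∸ 1) ≡⟨ cong (λ e → m ^ (e ∸ 1)) (+-identityʳ a) ⟩
  m ^ (a ∸ 1)     ≤⟨ ^-monoʳ-≤ m {{>-nonZero 1≤m}} (m∸n≤m a 1) ⟩
  m ^ a           ≡⟨ *-identityʳ (m ^ a) ⟨
  m ^ a * 1       ∎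
  where open ≤-Reasoning
m^[a+b∸1]≤m^a*m^[b∸1] {m} a (suc b) _ =
  ≤-reflexive (trans (cong (λ e → m ^ (e ∸ 1)) (+-suc a b)) (^-distribˡ-+-* m a b))

[m*n]^k≡m^k*n^k : ∀ m n k → (m * n) ^ k ≡ m ^ k * n ^ k
[m*n]^k≡m^k*n^k m n zero    = refl
[m*n]^k≡m^k*n^k m n (suc k) = begin
  m * n * (m * n) ^ k       ≡⟨ cong (m * n *_) ([m*n]^k≡m^k*n^k m n k) ⟩
  m * n * (m ^ k * n ^ k)   ≡⟨ interchange m n (m ^ k) (n ^ k) ⟩
  m * m ^ k * (n * n ^ k)   ∎
  where open ≡-Reasoning

-- Excess d x s: a phase of s vertices, in a graph of out-degree at most d, never lets the
-- boundary exceed its initial size by more than x.  In a node, the shortest (length s′) of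
-- the k sub-phases started at the new boundary vertices runs first while the other k − 1
-- of these vertices wait in the boundary.
data Excess (d : ℕ) : ℕ → ℕ → Set where
  leaf : ∀ {k s} → k ≤ d → k < s → Excess d k s
  node : ∀ {k x s′ s} → 1 ≤ k → k ≤ d → k * s′ < s → Excess d x s′ → Excess d (k ∸ 1 + x) s

module _ {d : ℕ} where

  Excess-weaken : ∀ {x s s′} → s ≤ s′ → Excess d x s → Excess d x s′
  Excess-weaken s≤s′ (leaf k≤d k<s)          = leaf k≤d (<-≤-trans k<s s≤s′)
  Excess-weaken s≤s′ (node 1≤k k≤d ks′<s ex) = node 1≤k k≤d (<-≤-trans ks′<s s≤s′) ex

  Excess⇒≤d : ∀ {x s} → d ≤ 1 → Excess d x s → x ≤ d
  Excess⇒≤d _   (leaf k≤d _) = k≤d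
  Excess⇒≤d d≤1 (node {k} {x} _ k≤d _ ex) = begin
    k ∸ 1 + x ≤⟨ +-monoˡ-≤ x (∸-monoˡ-≤ 1 (≤-trans k≤d d≤1)) ⟩
    x         ≤⟨ Excess⇒≤d d≤1 ex ⟩
    d         ∎
    where open ≤-Reasoning

  Excess⇒D^x≤s^D : ∀ {D x s} → d ≤ D → Excess d x s → D ^ (x ∸ 1) ≤ s ^ (D ∸ 1)
  Excess⇒D^x≤s^D {D} d≤D (leaf k≤d k<s) = D^[k∸1]≤s^[D∸1] (≤-trans k≤d d≤D) k<s
    where
    D^[k∸1]≤s^[D∸1] : ∀ {k s} → k ≤ D → k < s → D ^ (k ∸ 1) ≤ s ^ (D ∸ 1)
    D^[k∸1]≤s^[D∸1] {zero}      _   0<s = 1≤m^n (D ∸ 1) 0<s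
    D^[k∸1]≤s^[D∸1] {suc k} {s} k≤D k<s = begin
      D ^ k           ≤⟨ m^[k∸1]≤k^[m∸1] (s≤s z≤n) k≤D ⟩
      suc k ^ (D ∸ 1) ≤⟨ ^-monoˡ-≤ (D ∸ 1) (<⇒≤ k<s) ⟩
      s ^ (D ∸ 1)     ∎
      where open ≤-Reasoning
  Excess⇒D^x≤s^D {D} {s = s} d≤D (node {k} {x} {s′} 1≤k k≤d ks′<s ex) = begin
    D ^ (k ∸ 1 + x ∸ 1)             ≤⟨ m^[a+b∸1]≤m^a*m^[b∸1] (k ∸ 1) x (≤-trans 1≤k k≤D) ⟩
    D ^ (k ∸ 1) * D ^ (x ∸ 1)       ≤⟨ *-mono-≤ (m^[k∸1]≤k^[m∸1] 1≤k k≤D) (Excess⇒D^x≤s^D d≤D ex) ⟩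
    k ^ (D ∸ 1) * s′ ^ (D ∸ 1)      ≡⟨ [m*n]^k≡m^k*n^k k s′ (D ∸ 1) ⟨
    (k * s′) ^ (D ∸ 1)              ≤⟨ ^-monoˡ-≤ (D ∸ 1) (<⇒≤ ks′<s) ⟩
    s ^ (D ∸ 1)                     ∎
    where
    open ≤-Reasoning
    k≤D : k ≤ D
    k≤D = ≤-trans k≤d d≤D

unique-length-≤ : ∀ {A : Set} {xs ys : List A} → Unique xs → xs ⊆ ys → length xs ≤ length ys
unique-length-≤ {xs = []}     _            _     = z≤n
unique-length-≤ {xs = x ∷ xs} (x≢xs AllPairs.∷ uxs) xs⊆ys
  with ys₁ , ys₂ , refl ← ∈-∃++ (xs⊆ys (here refl)) = begin
    suc (length xs)            ≤⟨ s≤s (unique-length-≤ uxs xs⊆ys₁++ys₂) ⟩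
    suc (length (ys₁ ++ ys₂))  ≡⟨ length-++-sucʳ ys₁ x ys₂ ⟨
    length (ys₁ ++ x ∷ ys₂)    ∎
  where
  open ≤-Reasoning
  xs⊆ys₁++ys₂ : xs ⊆ ys₁ ++ ys₂
  xs⊆ys₁++ys₂ z∈xs with ∈-++⁻ ys₁ (xs⊆ys (there z∈xs))
  ... | inj₁ z∈ys₁         = ∈-++⁺ˡ z∈ys₁
  ... | inj₂ (here refl)   = contradiction z∈xs (All¬⇒¬Any x≢xs)
  ... | inj₂ (there z∈ys₂) = ∈-++⁺ʳ ys₁ z∈ys₂

concat-length-≥ : ∀ {A : Set} {m} (xss : List (List A)) → All (λ xs → m ≤ length xs) xss →
                  length xss * m ≤ length (concat xss)
concat-length-≥ []         []               = z≤n
concat-length-≥ (xs ∷ xss) (m≤xs ∷ m≤xss) = begin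
  _ + length xss * _                  ≤⟨ +-mono-≤ m≤xs (concat-length-≥ xss m≤xss) ⟩
  length xs + length (concat xss)     ≡⟨ length-++ xs ⟨
  length (xs ++ concat xss)           ∎
  where open ≤-Reasoning

disjoint-family-length : ∀ {A : Set} {m} {ys : List A} (xss : List (List A)) →
  All Unique xss → AllPairs Disjoint xss → All (_⊆ ys) xss → All (λ xs → m ≤ length xs) xss →
  length xss * m ≤ length ys
disjoint-family-length xss uniq disj xss⊆ys m≤xss =
  ≤-trans (concat-length-≥ xss m≤xss)
          (unique-length-≤ (concat⁺ uniq disj) (λ v∈ → let xs⊆ys , v∈xs = All.lookupAny xss⊆ys (∈-concat⁻ xss v∈) in xs⊆ys v∈xs))

module _ {n : ℕ} where

  unique-length-≤n : {xs : List (Fin n)} → Unique xs → length xs ≤ n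
  unique-length-≤n {xs} u = begin
    length xs          ≤⟨ unique-length-≤ u (λ {x} _ → ∈-allFin x) ⟩
    length (allFin n)  ≡⟨ length-tabulate (λ i → i) ⟩
    n                  ∎
    where open ≤-Reasoning

  ∈-tabulate⁺ : ∀ {f : Fin n → Bool} {x} → f x ≡ true → x ∈ₛ tabulate f
  ∈-tabulate⁺ {f} {x} fx = lookup⇒[]= x (tabulate f) (trans (lookup∘tabulate f x) fx)

  ∈-tabulate⁻ : ∀ {f : Fin n → Bool} {x} → x ∈ₛ tabulate f → f x ≡ true
  ∈-tabulate⁻ {f} {x} x∈ = trans (sym (lookup∘tabulate f x)) ([]=⇒lookup x∈)

∣p∪q∣≤∣p∣+∣q∣ : ∀ {n} (p q : Subset n) → ∣ p ∪ q ∣ ≤ ∣ p ∣ + ∣ q ∣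
∣p∪q∣≤∣p∣+∣q∣ []            []            = z≤n
∣p∪q∣≤∣p∣+∣q∣ (outside ∷ p) (outside ∷ q) = ∣p∪q∣≤∣p∣+∣q∣ p q
∣p∪q∣≤∣p∣+∣q∣ (inside  ∷ p) (outside ∷ q) = s≤s (∣p∪q∣≤∣p∣+∣q∣ p q)
∣p∪q∣≤∣p∣+∣q∣ (outside ∷ p) (inside  ∷ q) =
  ≤-trans (s≤s (∣p∪q∣≤∣p∣+∣q∣ p q)) (≤-reflexive (sym (+-suc ∣ p ∣ ∣ q ∣)))
∣p∪q∣≤∣p∣+∣q∣ (inside  ∷ p) (inside  ∷ q) =
  s≤s (≤-trans (∣p∪q∣≤∣p∣+∣q∣ p q) (+-monoʳ-≤ ∣ p ∣ (n≤1+n ∣ q ∣)))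

x∈p─q⇒x∉q : ∀ {n} {p q : Subset n} {x} → x ∈ₛ p ─ q → x ∉ₛ q
x∈p─q⇒x∉q {p = _ ∷ _}       (Vec.there x∈p─q) (Vec.there x∈q) = x∈p─q⇒x∉q x∈p─q x∈q
x∈p─q⇒x∉q {p = inside  ∷ _} ()                Vec.here
x∈p─q⇒x∉q {p = outside ∷ _} ()                Vec.here

x∈p-y⇒x≢y : ∀ {n} {p : Subset n} {x y} → x ∈ₛ p - y → x ≢ y
x∈p-y⇒x≢y x∈p-y refl = x∈p─q⇒x∉q x∈p-y (x∈⁅x⁆ _)

module _ {n : ℕ} where

  ∈⇒∈vset : ∀ {x} (xs : List (Fin n)) → x ∈ xs → x ∈ₛ vset xs
  ∈⇒∈vset (y ∷ _)  (here refl) = x∈p∪q⁺ (inj₁ (x∈⁅x⁆ y))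
  ∈⇒∈vset (_ ∷ xs) (there x∈)  = x∈p∪q⁺ (inj₂ (∈⇒∈vset xs x∈))

  ∈vset⇒∈ : ∀ {x} (xs : List (Fin n)) → x ∈ₛ vset xs → x ∈ xs
  ∈vset⇒∈ []       x∈ = contradiction x∈ ∉⊥
  ∈vset⇒∈ (y ∷ xs) x∈ with x∈p∪q⁻ ⁅ y ⁆ (vset xs) x∈
  ... | inj₁ x∈⁅y⁆ = here (x∈⁅y⁆⇒x≡y y x∈⁅y⁆)
  ... | inj₂ x∈xs  = there (∈vset⇒∈ xs x∈xs)

  ∣vset∣≤length : ∀ (xs : List (Fin n)) → ∣ vset xs ∣ ≤ length xs
  ∣vset∣≤length []       = ≤-reflexive (∣⊥∣≡0 n)
  ∣vset∣≤length (x ∷ xs) = begin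
    ∣ ⁅ x ⁆ ∪ vset xs ∣        ≤⟨ ∣p∪q∣≤∣p∣+∣q∣ ⁅ x ⁆ (vset xs) ⟩
    ∣ ⁅ x ⁆ ∣ + ∣ vset xs ∣    ≡⟨ cong (_+ ∣ vset xs ∣) (∣⁅x⁆∣≡1 x) ⟩
    suc ∣ vset xs ∣            ≤⟨ s≤s (∣vset∣≤length xs) ⟩
    suc (length xs)            ∎
    where open ≤-Reasoning

  ∣p∣≤length : ∀ {p : Subset n} (xs : List (Fin n)) → (∀ {x} → x ∈ₛ p → x ∈ xs) → ∣ p ∣ ≤ length xs
  ∣p∣≤length {p} xs p⊆xs = ≤-trans (p⊆q⇒∣p∣≤∣q∣ (∈⇒∈vset xs ∘ p⊆xs)) (∣vset∣≤length xs)

  ⊆∪⇒∣p∣≤∣q∣+∣r∣ : ∀ {p q r : Subset n} → (∀ {x} → x ∈ₛ p → x ∈ₛ q ∪ r) → ∣ p ∣ ≤ ∣ q ∣ + ∣ r ∣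
  ⊆∪⇒∣p∣≤∣q∣+∣r∣ {p} {q} {r} p⊆q∪r = ≤-trans (p⊆q⇒∣p∣≤∣q∣ p⊆q∪r) (∣p∪q∣≤∣p∣+∣q∣ q r)

  x∈p⇒0<∣p∣ : ∀ {p : Subset n} {x} → x ∈ₛ p → 0 < ∣ p ∣
  x∈p⇒0<∣p∣ x∈p = ≤-<-trans z≤n (x∈p⇒∣p-x∣<∣p∣ x∈p)

  0<∣p∣⇒Nonempty : ∀ {p : Subset n} → 0 < ∣ p ∣ → Nonempty p
  0<∣p∣⇒Nonempty {p} 0<∣p∣ with nonempty? p
  ... | yes ne  = ne
  ... | no  ¬ne = contradiction (trans (cong ∣_∣ (Empty-unique ¬ne)) (∣⊥∣≡0 n)) (≢-sym (<⇒≢ 0<∣p∣))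

≤-foldr-⊔ : ∀ {x xs} → x ∈ xs → x ≤ foldr _⊔_ 0 xs
≤-foldr-⊔ {x} {xs} x∈xs =
  foldr-preservesᵒ (λ a b → [ m≤n⇒m≤n⊔o b , m≤n⇒m≤o⊔n a ]′) 0 xs (inj₂ (Any.map ≤-reflexive x∈xs))

data Incremental {A : Set} (R : List A → A → Set) (T : List A) : List A → Set where
  []  : Incremental R T []
  _∷_ : ∀ {x xs} → R T x → Incremental R (T ++ [ x ]) xs → Incremental R T (x ∷ xs)

module _ {A : Set} {R : List A → A → Set} where

  Incremental-++ : ∀ {T} xs {ys} → Incremental R T xs → Incremental R (T ++ xs) ys → Incremental R T (xs ++ ys)
  Incremental-++ {T} []       {ys} []         rys = subst (λ U → Incremental R U ys) (++-identityʳ T) rys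
  Incremental-++ {T} (x ∷ xs) {ys} (rx ∷ rxs) rys =
    rx ∷ Incremental-++ xs rxs (subst (λ U → Incremental R U ys) (sym (++-assoc T [ x ] xs)) rys)

  Incremental-map : ∀ {R′ : List A → A → Set} → (∀ {U x} → R U x → R′ U x) →
                    ∀ {T xs} → Incremental R T xs → Incremental R′ T xs
  Incremental-map f []         = []
  Incremental-map f (rx ∷ rxs) = f rx ∷ Incremental-map f rxs

  Incremental-lookup : ∀ {T xs} → Incremental R T xs → (i : Fin (length xs)) → R (T ++ take (toℕ i) xs) (lookup xs i)
  Incremental-lookup {T} (rx ∷ _) fzero = subst (λ U → R U _) (sym (++-identityʳ T)) rx
  Incremental-lookup {T} (_∷_ {x} {xs} _ rxs) (fsuc i) =
    subst (λ U → R U (lookup xs i)) (++-assoc T [ x ] (take (toℕ i) xs)) (Incremental-lookup rxs i)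

AllPrefixes : ∀ {A : Set} → (List A → Set) → List A → List A → Set
AllPrefixes P = Incremental (λ U x → P (U ++ [ x ]))

AllPrefixes-take : ∀ {A : Set} {P : List A → Set} {T xs} → AllPrefixes P T xs →
                   ∀ {i} → i < length xs → P (T ++ take (suc i) xs)
AllPrefixes-take (px ∷ _) {zero} _ = px
AllPrefixes-take {P = P} {T} (_∷_ {x} {xs} _ pxs) {suc i} (s≤s i<) =
  subst P (++-assoc T [ x ] (take (suc i) xs)) (AllPrefixes-take {P = P} pxs i<)

module Topological {n : ℕ} (E : Graph n) where

  open import Data.List.Membership.DecPropositional (_≟_ {n}) using (_∈?_)

  Edge : Fin n → Fin n → Set
  Edge u v = E u v ≡ true

  edge? : ∀ u v → Dec (Edge u v)
  edge? u v = E u v Bool.≟ true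

  _⇝_ : Fin n → Fin n → Set
  _⇝_ = Star Edge

  ⇝-last : ∀ {x y} → x ⇝ y → x ≢ y → ∃[ p ] (x ⇝ p × Edge p y)
  ⇝-last ε x≢y = contradiction refl x≢y
  ⇝-last {x} {y} (_◅_ {j = a} x→a a⇝y) _ with a ≟ y
  ... | yes refl = x , ε , x→a
  ... | no  a≢y  with p , a⇝p , p→y ← ⇝-last a⇝y a≢y = p , x→a ◅ a⇝p , p→y

  PredsIn : List (Fin n) → Fin n → Set
  PredsIn T v = ∀ u → Edge u v → u ∈ T

  predsIn? : ∀ T v → Dec (PredsIn T v)
  predsIn? T v = all? (λ u → edge? u v →-dec (u ∈? T))

  ¬predsIn⇒outsidePred : ∀ {T v} → ¬ PredsIn T v → ∃[ u ] (Edge u v × u ∉ T)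
  ¬predsIn⇒outsidePred {T} {v} ¬preds = pick (¬∀⟶∃¬ n _ (λ u → edge? u v →-dec (u ∈? T)) ¬preds)
    where
    pick : ∃[ u ] ¬ (Edge u v → u ∈ T) → ∃[ u ] (Edge u v × u ∉ T)
    pick (u , ¬[u→v⇒u∈T]) with edge? u v
    ... | yes u→v = u , u→v , λ u∈T → ¬[u→v⇒u∈T] (λ _ → u∈T)
    ... | no ¬u→v = contradiction (λ u→v → contradiction u→v ¬u→v) ¬[u→v⇒u∈T]

  Ready : List (Fin n) → Fin n → Set
  Ready T v = v ∉ T × PredsIn T v

  InBoundary : List (Fin n) → Fin n → Set
  InBoundary T v = Ready T v × ∃[ u ] Edge u v

  B : List (Fin n) → Subset n
  B = boundary (rTop E)

  private
    boundary? : ∀ T v → Dec _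
    boundary? T v = ¬? (v SP.∈? vset T)
      ×-dec Any.any? (λ Q → nonempty? Q ×-dec (Q SP.⊆? vset T)) (enablers (rTop E) v)

  ∈B⁻ : ∀ {T v} → v ∈ₛ B T → InBoundary T v
  ∈B⁻ {T} {v} v∈B
    with v∉T , here ((u , u∈pred) , pred⊆T) ← toWitness {a? = boundary? T v} (Equivalence.from T-≡ (∈-tabulate⁻ v∈B)) =
    (v∉T ∘ ∈⇒∈vset T , λ w w→v → ∈vset⇒∈ T (pred⊆T (∈-tabulate⁺ w→v))) , u , ∈-tabulate⁻ u∈pred

  ∈B⁺ : ∀ {T v} → InBoundary T v → v ∈ₛ B T
  ∈B⁺ {T} {v} ((v∉T , preds) , u , u→v) = ∈-tabulate⁺ {f = λ v → ⌊ boundary? T v ⌋} (Equivalence.to T-≡ (fromWitness {a? = boundary? T v}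
    (v∉T ∘ ∈vset⇒∈ T , here ((u , ∈-tabulate⁺ u→v) , λ w∈pred → ∈⇒∈vset T (preds _ (∈-tabulate⁻ w∈pred))))))

  ReadySeq : List (Fin n) → List (Fin n) → Set
  ReadySeq = Incremental Ready

  ReadySeq⇒∉ : ∀ {T φ y} → ReadySeq T φ → y ∈ φ → y ∉ T
  ReadySeq⇒∉ ((x∉T , _) ∷ _) (here refl) = x∉T
  ReadySeq⇒∉ (_ ∷ r)         (there y∈φ) = ReadySeq⇒∉ r y∈φ ∘ ∈-++⁺ˡ

  ReadySeq⇒Unique : ∀ {T φ} → ReadySeq T φ → Unique φ
  ReadySeq⇒Unique []                = AllPairs.[]
  ReadySeq⇒Unique {T} (_∷_ {x} _ r) =
    All.tabulate (λ y∈φ x≡y → ReadySeq⇒∉ r y∈φ (∈-++⁺ʳ T (here (sym x≡y)))) AllPairs.∷ ReadySeq⇒Unique r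

  PredClosed : List (Fin n) → Set
  PredClosed T = ∀ {v} → v ∈ T → PredsIn T v

  predClosed-⇝ : ∀ {T x y} → PredClosed T → y ∈ T → x ⇝ y → x ∈ T
  predClosed-⇝ cl y∈T ε             = y∈T
  predClosed-⇝ cl y∈T (x→a ◅ a⇝y) = cl (predClosed-⇝ cl y∈T a⇝y) _ x→a

  ReadySeq⇒PredClosed : ∀ {T φ} → PredClosed T → ReadySeq T φ → PredClosed (T ++ φ)
  ReadySeq⇒PredClosed {T} cl [] = subst PredClosed (sym (++-identityʳ T)) cl
  ReadySeq⇒PredClosed {T} cl (_∷_ {x} {φ} (_ , preds) r) =
    subst PredClosed (++-assoc T [ x ] φ) (ReadySeq⇒PredClosed cl′ r)
    where
    cl′ : PredClosed (T ++ [ x ])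
    cl′ v∈ with ∈-++⁻ T v∈
    ... | inj₁ v∈T         = λ u u→v → ∈-++⁺ˡ (cl v∈T u u→v)
    ... | inj₂ (here refl) = λ u u→v → ∈-++⁺ˡ (preds u u→v)

  prefix⇒PredClosed : ∀ {T} → ReadySeq [] T → PredClosed T
  prefix⇒PredClosed = ReadySeq⇒PredClosed (λ ())

  Dominates : List (Fin n) → Fin n → Fin n → Set
  Dominates T c y = ∀ z → z ∉ T → z ⇝ y → c ⇝ z

  dominates-self : ∀ {T c} → PredClosed T → Ready T c → Dominates T c c
  dominates-self {c = c} cl (_ , preds) z z∉T z⇝c with z ≟ c
  ... | yes refl = ε
  ... | no  z≢c with p , z⇝p , p→c ← ⇝-last z⇝c z≢c = contradiction (predClosed-⇝ cl (preds p p→c) z⇝p) z∉T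

  dominates-lift : ∀ {S T w c y} → (∀ {z} → z ∈ T → z ∉ S → w ⇝ z) → w ⇝ c →
                   Dominates T c y → Dominates S w y
  dominates-lift {T = T} reach w⇝c dom z z∉S z⇝y with z ∈? T
  ... | yes z∈T = reach z∈T z∉S
  ... | no  z∉T = w⇝c ◅◅ dom z z∉T z⇝y

  dominated⇒outsidePred : ∀ {T c y} → PredClosed T → c ∉ T → y ∉ T → y ≢ c →
                          Dominates T c y → ∃[ p ] (Edge p y × p ∉ T)
  dominated⇒outsidePred cl c∉T y∉T y≢c dom with p , c⇝p , p→y ← ⇝-last (dom _ y∉T ε) (y≢c ∘ sym) =
    p , p→y , λ p∈T → c∉T (predClosed-⇝ cl p∈T c⇝p)

  dominated-disjoint : ∀ {T c₁ c₂ y} → PredClosed T → c₁ ∉ T → Ready T c₂ → c₁ ≢ c₂ → y ∉ T →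
                       Dominates T c₁ y → ¬ Dominates T c₂ y
  dominated-disjoint cl c₁∉T (c₂∉T , preds₂) c₁≢c₂ y∉T dom₁ dom₂
    with p , c₁⇝p , p→c₂ ← ⇝-last (dom₁ _ c₂∉T (dom₂ _ y∉T ε)) c₁≢c₂ =
    c₁∉T (predClosed-⇝ cl (preds₂ p p→c₂) c₁⇝p)

  ReadySeq⇒IsRVisit : ∀ {ψ} → ReadySeq [] ψ → (∀ v → v ∈ ψ) → IsRVisit (rTop E) ψ
  ReadySeq⇒IsRVisit {ψ} seq covers =
    (ReadySeq⇒Unique seq , λ i → here λ u∈pred →
      ∈⇒∈vset (take (toℕ i) ψ) (proj₂ (Incremental-lookup seq i) _ (∈-tabulate⁻ u∈pred))) , covers

  bnum-elim : ∀ (P : ℕ → Set) {ψ} → P 0 → (∀ {i} → i < length ψ → P ∣ B (take (suc i) ψ) ∣) →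
              P (bnum (rTop E) ψ)
  bnum-elim P {ψ} P0 Pprefix with foldr-selective ⊔-sel 0 (applyUpTo (λ i → ∣ B (take (suc i) ψ) ∣) (length ψ))
  ... | inj₁ bnum≡0 = subst P (sym bnum≡0) P0
  ... | inj₂ bnum∈  with i , i< , bnum≡ ← ∈-applyUpTo⁻ (λ i → ∣ B (take (suc i) ψ) ∣) bnum∈ = subst P (sym bnum≡) (Pprefix i<)

  prefix≤bnum : ∀ {ψ i} → i < length ψ → ∣ B (take (suc i) ψ) ∣ ≤ bnum (rTop E) ψ
  prefix≤bnum {ψ} i< = ≤-foldr-⊔ (∈-applyUpTo⁺ (λ i → ∣ B (take (suc i) ψ) ∣) i<)

  edge⇒1≤bnum : ∀ {ψ u v} → ReadySeq [] ψ → u ∈ ψ → Edge v u → 1 ≤ bnum (rTop E) ψ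
  edge⇒1≤bnum {ψ} {u} {v} seq u∈ψ v→u =
    at (toℕ i) (toℕ<n i) (subst (Ready (take (toℕ i) ψ)) (sym (lookup-index u∈ψ)) (Incremental-lookup seq i))
    where
    i : Fin (length ψ)
    i = Any.index u∈ψ
    at : ∀ t → t < length ψ → Ready (take t ψ) u → 1 ≤ bnum (rTop E) ψ
    at zero    _    (_ , preds) = contradiction (preds v v→u) λ ()
    at (suc t) t<ψ  r           = ≤-trans (x∈p⇒0<∣p∣ (∈B⁺ {take (suc t) ψ} (r , v , v→u))) (prefix≤bnum {ψ} (<⇒≤ t<ψ))

  outDeg≤maxOutDeg : ∀ v → ∣ sucSet E v ∣ ≤ maxOutDeg E
  outDeg≤maxOutDeg v = ≤-foldr-⊔ (∈-map⁺ (λ v → ∣ sucSet E v ∣) (∈-allFin v))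

  0<maxOutDeg⇒edge : 0 < maxOutDeg E → ∃[ v ] ∃[ u ] Edge v u
  0<maxOutDeg⇒edge 0<max with foldr-selective ⊔-sel 0 (map (λ v → ∣ sucSet E v ∣) (allFin n))
  ... | inj₁ max≡0 = contradiction max≡0 (≢-sym (<⇒≢ 0<max))
  ... | inj₂ max∈  with v , _ , max≡ ← ∈-map⁻ (λ v → ∣ sucSet E v ∣) max∈
                   with u , u∈suc ← 0<∣p∣⇒Nonempty (subst (0 <_) max≡ 0<max) = v , u , ∈-tabulate⁻ u∈suc

module Phases {n : ℕ} (E : Graph n) {d : ℕ} (outDeg≤d : ∀ v → ∣ sucSet E v ∣ ≤ d) where
  open Topological E
  open import Data.List.Membership.DecPropositional (_≟_ {n}) using (_∈?_)

  ΔB : List (Fin n) → List (Fin n) → Subset n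
  ΔB S T = B T ─ B S

  ∈ΔB⁻ : ∀ {S T v} → v ∈ₛ ΔB S T → InBoundary T v × v ∉ₛ B S
  ∈ΔB⁻ {S} {T} v∈ΔB = ∈B⁻ (p─q⊆p (B T) (B S) v∈ΔB) , x∈p─q⇒x∉q v∈ΔB

  ∈ΔB⇒Ready : ∀ {S T v} → v ∈ₛ ΔB S T → Ready T v
  ∈ΔB⇒Ready {S} {T} = proj₁ ∘ proj₁ ∘ ∈ΔB⁻ {S} {T}

  record BoundaryWithin (base s : ℕ) (U : List (Fin n)) : Set where
    constructor within
    field
      excess     : ℕ
      admissible : Excess d excess s
      bounded    : ∣ B U ∣ ≤ base + excess

  within-weaken : ∀ {base base′ s s′ U} → base ≤ base′ → s ≤ s′ →
                  BoundaryWithin base s U → BoundaryWithin base′ s′ U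
  within-weaken {U = U} base≤ s≤s′ (within x ex B≤) =
    within x (Excess-weaken s≤s′ ex) (≤-trans B≤ (+-monoˡ-≤ x base≤))

  within-node : ∀ {base base′ k s′ s U} → 1 ≤ k → k ≤ d → k * s′ < s → base ≤ base′ + (k ∸ 1) →
                BoundaryWithin base s′ U → BoundaryWithin base′ s U
  within-node {base} {base′} {k} {U = U} 1≤k k≤d ks′<s base≤ (within x ex B≤) =
    within (k ∸ 1 + x) (node 1≤k k≤d ks′<s ex) (begin
      ∣ B U ∣              ≤⟨ B≤ ⟩
      base + x             ≤⟨ +-monoˡ-≤ x base≤ ⟩
      base′ + (k ∸ 1) + x  ≡⟨ +-assoc base′ (k ∸ 1) x ⟩
      base′ + (k ∸ 1 + x)  ∎)
    where open ≤-Reasoning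

  record Phase (T : List (Fin n)) (c : Fin n) : Set where
    field
      visit     : List (Fin n)
      ready     : ReadySeq T visit
      dominated : ∀ {y} → y ∈ visit → Dominates T c y
      closed    : B (T ++ visit) ⊆ₛ B T
      starts    : c ∈ visit
      bounded   : AllPrefixes (BoundaryWithin ∣ B T - c ∣ (length visit)) T visit

  -- What remains, after the current prefix T, of the phase started at w after the prefix S.
  record PhaseTail (S : List (Fin n)) (w : Fin n) (T : List (Fin n)) : Set where
    field
      rest      : List (Fin n)
      ready     : ReadySeq T rest
      dominated : ∀ {y} → y ∈ rest → Dominates S w y
      closed    : B (T ++ rest) ⊆ₛ B S
      long      : ∣ ΔB S T ∣ ≤ length rest
      bounded   : AllPrefixes (BoundaryWithin ∣ B S - w ∣ (suc (length rest))) T rest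

  record TailState (S : List (Fin n)) (w : Fin n) (T : List (Fin n)) : Set where
    field
      prefix  : ReadySeq [] T
      S⊆T     : S ⊆ T
      w∈T     : w ∈ T
      reach   : ∀ {y} → y ∈ T → y ∉ S → w ⇝ y
      ΔB⊆suc  : ∀ {v} → v ∈ₛ ΔB S T → Edge w v

  -- The fuel m bounds the number of vertices not yet visited.
  PhaseFrom : ℕ → Set
  PhaseFrom m = ∀ {T c} → ReadySeq [] T → Ready T c → n ≤ length T + m → Phase T c

  B-reassoc : ∀ {T φ ρ X} → B ((T ++ φ) ++ ρ) ⊆ₛ X → B (T ++ φ ++ ρ) ⊆ₛ X
  B-reassoc {T} {φ} {ρ} B⊆X = B⊆X ∘ subst (λ U → _ ∈ₛ B U) (sym (++-assoc T φ ρ))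

  ∣ΔB∣≤d : ∀ {S w T} → TailState S w T → ∣ ΔB S T ∣ ≤ d
  ∣ΔB∣≤d {w = w} inv = ≤-trans (p⊆q⇒∣p∣≤∣q∣ (∈-tabulate⁺ ∘ TailState.ΔB⊆suc inv)) (outDeg≤d w)

  boundary-split : ∀ {S T w} → w ∈ T → ∀ {v} → v ∈ₛ B T → v ∈ₛ (B S - w) ∪ ΔB S T
  boundary-split {S} w∈T {v} v∈BT with v SP.∈? B S
  ... | yes v∈BS = x∈p∪q⁺ (inj₁ (x∈p∧x≢y⇒x∈p-y v∈BS λ { refl → proj₁ (proj₁ (∈B⁻ v∈BT)) w∈T }))
  ... | no  v∉BS = x∈p∪q⁺ (inj₂ (x∈p∧x∉q⇒x∈p─q v∈BT v∉BS))

  initial-state : ∀ {T c} → ReadySeq [] T → Ready T c → TailState T c (T ++ [ c ])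
  initial-state {T} {c} pre rc = record
    { prefix = Incremental-++ T pre (rc ∷ [])
    ; S⊆T    = ∈-++⁺ˡ
    ; w∈T    = ∈-++⁺ʳ T (here refl)
    ; reach  = reach
    ; ΔB⊆suc = ΔB⊆suc
    }
    where
    reach : ∀ {y} → y ∈ T ++ [ c ] → y ∉ T → c ⇝ y
    reach y∈ y∉T with ∈-++⁻ T y∈
    ... | inj₁ y∈T         = contradiction y∈T y∉T
    ... | inj₂ (here refl) = ε
    ΔB⊆suc : ∀ {v} → v ∈ₛ ΔB T (T ++ [ c ]) → Edge c v
    ΔB⊆suc {v} v∈ΔB with ((v∉T+c , preds) , hasPred) , v∉BT ← ∈ΔB⁻ {T} {T ++ [ c ]} v∈ΔB with predsIn? T v
    ... | yes predsT = contradiction (∈B⁺ {T} ((v∉T+c ∘ ∈-++⁺ˡ , predsT) , hasPred)) v∉BT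
    ... | no ¬predsT with u , u→v , u∉T ← ¬predsIn⇒outsidePred ¬predsT with ∈-++⁻ T (preds u u→v)
    ...   | inj₁ u∈T         = contradiction u∈T u∉T
    ...   | inj₂ (here refl) = u→v

  ΔB-shrinks : ∀ {S T c} (φ : Phase T c) → ∀ {v} → v ∈ₛ ΔB S (T ++ Phase.visit φ) → v ∈ₛ ΔB S T - c
  ΔB-shrinks {S} {T} {c} φ {v} v∈ΔB with inB , v∉BS ← ∈ΔB⁻ {S} {T ++ Phase.visit φ} v∈ΔB =
    x∈p∧x≢y⇒x∈p-y (x∈p∧x∉q⇒x∈p─q (Phase.closed φ (∈B⁺ inB)) v∉BS)
                  λ { refl → proj₁ (proj₁ inB) (∈-++⁺ʳ T (Phase.starts φ)) }

  state-extend : ∀ {S w T c} → TailState S w T → c ∈ₛ ΔB S T → (φ : Phase T c) →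
                 TailState S w (T ++ Phase.visit φ)
  state-extend {S} {w} {T} {c} inv c∈ΔB φ = record
    { prefix = Incremental-++ T prefix (Phase.ready φ)
    ; S⊆T    = ∈-++⁺ˡ ∘ S⊆T
    ; w∈T    = ∈-++⁺ˡ w∈T
    ; reach  = reach′
    ; ΔB⊆suc = ΔB⊆suc ∘ p─q⊆p (ΔB S T) _ ∘ ΔB-shrinks {S} φ
    }
    where
    open TailState inv
    reach′ : ∀ {y} → y ∈ T ++ Phase.visit φ → y ∉ S → w ⇝ y
    reach′ y∈ y∉S with ∈-++⁻ T y∈
    ... | inj₁ y∈T = reach y∈T y∉S
    ... | inj₂ y∈φ = ΔB⊆suc c∈ΔB ◅ Phase.dominated φ y∈φ _ (ReadySeq⇒∉ (Phase.ready φ) y∈φ) ε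

  dominated-visited : ∀ {S T Te c} → PredClosed T → S ⊆ T → B Te ⊆ₛ B S → c ∈ₛ ΔB S T →
                      ∀ {U φ} → T ⊆ U → U ⊆ Te → ReadySeq U φ →
                      (∀ {y} → y ∈ φ → Dominates T c y) → φ ⊆ Te
  dominated-visited cl S⊆T BTe⊆BS c∈ΔB T⊆U U⊆Te [] dom ()
  dominated-visited {S} {T} {Te} {c} cl S⊆T BTe⊆BS c∈ΔB {U} T⊆U U⊆Te (_∷_ {x} (x∉U , predsU) r) dom
    = λ { (here refl)  → x∈Te
        ; (there y∈φ) → dominated-visited cl S⊆T BTe⊆BS c∈ΔB (∈-++⁺ˡ ∘ T⊆U) U+x⊆Te r (dom ∘ there) y∈φ }
    where
    c∉T : c ∉ T
    c∉T = proj₁ (∈ΔB⇒Ready {S} c∈ΔB)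
    c-hasPred : ∃[ u ] Edge u c
    c-hasPred = proj₂ (proj₁ (∈ΔB⁻ {S} {T} c∈ΔB))
    c∉BS : c ∉ₛ B S
    c∉BS = proj₂ (∈ΔB⁻ {S} {T} c∈ΔB)
    x∈BS : ∃[ u ] Edge u x → x ∉ Te → x ∈ₛ B S
    x∈BS hasPred x∉Te = BTe⊆BS (∈B⁺ {Te} ((x∉Te , λ u u→x → U⊆Te (predsU u u→x)) , hasPred))
    -- Otherwise x would lie in B Te ⊆ B S: impossible for the new vertex c, and for any
    -- other x because a predecessor of x lies outside T ⊇ S.
    x∈Te : x ∈ Te
    x∈Te with x ∈? Te | x ≟ c
    ... | yes x∈Te | _        = x∈Te
    ... | no  x∉Te | yes refl = contradiction (x∈BS c-hasPred x∉Te) c∉BS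
    ... | no  x∉Te | no  x≢c
      with p , p→x , p∉T ← dominated⇒outsidePred cl c∉T (x∉U ∘ T⊆U) x≢c (dom (here refl))
      = contradiction (S⊆T (proj₂ (proj₁ (∈B⁻ {S} (x∈BS (p , p→x) x∉Te))) p p→x)) p∉T
    U+x⊆Te : U ++ [ x ] ⊆ Te
    U+x⊆Te y∈ with ∈-++⁻ U y∈
    ... | inj₁ y∈U         = U⊆Te y∈U
    ... | inj₂ (here refl) = x∈Te

  record Candidate (S T : List (Fin n)) : Set where
    constructor candidate
    field
      center    : Fin n
      new       : center ∈ₛ ΔB S T
      phaseFrom : Phase T center

  visitOf : ∀ {S T} → Candidate S T → List (Fin n)
  visitOf = Phase.visit ∘ Candidate.phaseFrom

  candidate-visited : ∀ {S T ρ} → PredClosed T → S ⊆ T → B (T ++ ρ) ⊆ₛ B S →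
                      (cand : Candidate S T) → visitOf cand ⊆ ρ
  candidate-visited {S} {T} cl S⊆T closed (candidate c c∈ΔB φ) y∈φ
    with ∈-++⁻ T (dominated-visited {S} cl S⊆T closed c∈ΔB (λ y∈T → y∈T) ∈-++⁺ˡ (Phase.ready φ) (Phase.dominated φ) y∈φ)
  ... | inj₁ y∈T = contradiction y∈T (ReadySeq⇒∉ (Phase.ready φ) y∈φ)
  ... | inj₂ y∈ρ = y∈ρ

  candidates-disjoint : ∀ {S T} → PredClosed T → {cand₁ cand₂ : Candidate S T} →
                        Candidate.center cand₁ ≢ Candidate.center cand₂ → Disjoint (visitOf cand₁) (visitOf cand₂)
  candidates-disjoint {S} {T} cl {candidate c₁ c₁∈ΔB φ₁} {candidate c₂ c₂∈ΔB φ₂} c₁≢c₂ (y∈φ₁ , y∈φ₂) =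
    dominated-disjoint cl (proj₁ (∈ΔB⇒Ready {S} {T} c₁∈ΔB)) (∈ΔB⇒Ready {S} {T} c₂∈ΔB) c₁≢c₂
      (ReadySeq⇒∉ (Phase.ready φ₁) y∈φ₁) (Phase.dominated φ₁ y∈φ₁) (Phase.dominated φ₂ y∈φ₂)

  candidates-length : ∀ {S T ρ m} → PredClosed T → S ⊆ T → B (T ++ ρ) ⊆ₛ B S →
                      (cands : List (Candidate S T)) → Unique (map Candidate.center cands) →
                      (∀ {v} → v ∈ₛ ΔB S T → v ∈ map Candidate.center cands) →
                      All (λ cand → m ≤ length (visitOf cand)) cands → ∣ ΔB S T ∣ * m ≤ length ρ
  candidates-length {S} {T} {ρ} {m} cl S⊆T closed cands centers-unique ΔB⊆centers short = begin
    ∣ ΔB S T ∣ * m                          ≤⟨ *-monoˡ-≤ m (∣p∣≤length _ ΔB⊆centers) ⟩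
    length (map Candidate.center cands) * m ≡⟨ cong (_* m) (length-map Candidate.center cands) ⟩
    length cands * m                        ≡⟨ cong (_* m) (length-map visitOf cands) ⟨
    length (map visitOf cands) * m          ≤⟨ disjoint-family-length (map visitOf cands) uniq disjoint visited
                                                 (All-map⁺ short) ⟩
    length ρ                                ∎
    where
    open ≤-Reasoning
    uniq : All Unique (map visitOf cands)
    uniq = All-map⁺ (All.universal (λ (cand : Candidate S T) → ReadySeq⇒Unique (Phase.ready (Candidate.phaseFrom cand))) cands)
    disjoint : AllPairs Disjoint (map visitOf cands)
    disjoint = AllPairs-map⁺ (AllPairs.map (λ {c₁} {c₂} → candidates-disjoint {S} {T} cl {c₁} {c₂})
                                           (AllPairs-map⁻ {f = Candidate.center} {xs = cands} centers-unique))
    visited : All (_⊆ ρ) (map visitOf cands)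
    visited = All-map⁺ (All.universal (candidate-visited {S} cl S⊆T closed) cands)

  candidates : ∀ {m S T} → PhaseFrom m → ReadySeq [] T → n ≤ length T + m →
               (L : List (Fin n)) → (∀ {c} → c ∈ L → c ∈ₛ ΔB S T) → List (Candidate S T)
  candidates phase pre fuel []      _   = []
  candidates {S = S} {T} phase pre fuel (c ∷ L) L⊆ΔB =
    candidate c c∈ΔB (phase pre (∈ΔB⇒Ready {S} {T} c∈ΔB) fuel) ∷ candidates {S = S} phase pre fuel L (L⊆ΔB ∘ there)
    where
    c∈ΔB : c ∈ₛ ΔB S T
    c∈ΔB = L⊆ΔB (here refl)

  centers-candidates : ∀ {m S T} (phase : PhaseFrom m) (pre : ReadySeq [] T) (fuel : n ≤ length T + m) L
                       (L⊆ΔB : ∀ {c} → c ∈ L → c ∈ₛ ΔB S T) → map Candidate.center (candidates {S = S} phase pre fuel L L⊆ΔB) ≡ L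
  centers-candidates phase pre fuel []      _   = refl
  centers-candidates {S = S} phase pre fuel (c ∷ L) L⊆ΔB =
    cong (c ∷_) (centers-candidates {S = S} phase pre fuel L (L⊆ΔB ∘ there))

  phase-tail-done : ∀ {S w T} → TailState S w T → ¬ Nonempty (ΔB S T) → PhaseTail S w T
  phase-tail-done {S} {w} {T} inv ΔB-empty = record
    { rest      = []
    ; ready     = []
    ; dominated = λ ()
    ; closed    = closed ∘ subst (λ U → _ ∈ₛ B U) (++-identityʳ T)
    ; long      = ≤-reflexive (trans (cong ∣_∣ (Empty-unique ΔB-empty)) (∣⊥∣≡0 n))
    ; bounded   = []
    }
    where
    closed : B T ⊆ₛ B S
    closed {v} v∈BT with v SP.∈? B S
    ... | yes v∈BS = v∈BS
    ... | no  v∉BS = contradiction (v , x∈p∧x∉q⇒x∈p─q v∈BT v∉BS) ΔB-empty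

  phase-tail-extend : ∀ {S w T c} → TailState S w T → c ∈ₛ ΔB S T → (φ : Phase T c) →
                      (l : PhaseTail S w (T ++ Phase.visit φ)) →
                      ∣ ΔB S T ∣ * length (Phase.visit φ) ≤ length (Phase.visit φ ++ PhaseTail.rest l) →
                      PhaseTail S w T
  phase-tail-extend {S} {w} {T} {c} inv c∈ΔB φ l counted = record
    { rest      = φ.visit ++ l.rest
    ; ready     = Incremental-++ φ.visit φ.ready l.ready
    ; dominated = dominated
    ; closed    = B-reassoc {T} l.closed
    ; long      = ≤-trans (m≤m*n k (length φ.visit) {{>-nonZero (∈-length φ.starts)}}) counted
    ; bounded   = Incremental-++ φ.visit (Incremental-map lift-φ φ.bounded) (Incremental-map lift-l l.bounded)
    }
    where
    open TailState inv
    module φ = Phase φ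
    module l = PhaseTail l
    k : ℕ
    k = ∣ ΔB S T ∣
    dominated : ∀ {y} → y ∈ φ.visit ++ l.rest → Dominates S w y
    dominated y∈ with ∈-++⁻ φ.visit y∈
    ... | inj₁ y∈φ = dominates-lift reach (ΔB⊆suc c∈ΔB ◅ ε) (φ.dominated y∈φ)
    ... | inj₂ y∈l = l.dominated y∈l
    B-c⊆ : ∀ {v} → v ∈ₛ B T - c → v ∈ₛ (B S - w) ∪ (ΔB S T - c)
    B-c⊆ {v} v∈ with x∈p∪q⁻ (B S - w) (ΔB S T) (boundary-split {S} w∈T (p─q⊆p (B T) _ v∈))
    ... | inj₁ v∈BS-w = x∈p∪q⁺ (inj₁ v∈BS-w)
    ... | inj₂ v∈ΔB   = x∈p∪q⁺ (inj₂ (x∈p∧x≢y⇒x∈p-y v∈ΔB (x∈p-y⇒x≢y v∈)))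
    base≤ : ∣ B T - c ∣ ≤ ∣ B S - w ∣ + (k ∸ 1)
    base≤ = ≤-trans (⊆∪⇒∣p∣≤∣q∣+∣r∣ B-c⊆) (+-monoʳ-≤ ∣ B S - w ∣ (∸-monoˡ-≤ 1 (x∈p⇒∣p-x∣<∣p∣ c∈ΔB)))
    lift-φ : ∀ {U} → BoundaryWithin ∣ B T - c ∣ (length φ.visit) U →
             BoundaryWithin ∣ B S - w ∣ (suc (length (φ.visit ++ l.rest))) U
    lift-φ = within-node (x∈p⇒0<∣p∣ c∈ΔB) (∣ΔB∣≤d inv) (s≤s counted) base≤
    lift-l : ∀ {U} → BoundaryWithin ∣ B S - w ∣ (suc (length l.rest)) U →
             BoundaryWithin ∣ B S - w ∣ (suc (length (φ.visit ++ l.rest))) U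
    lift-l = within-weaken ≤-refl (s≤s (length-++-≤ʳ l.rest {φ.visit}))

  phase-tail : ∀ {m} → PhaseFrom m → ∀ {S w} k {T} → TailState S w T → n ≤ length T + m →
               ∣ ΔB S T ∣ ≤ k → PhaseTail S w T
  phase-tail phase {S} {w} k {T} inv fuel ΔB≤k with nonempty? (ΔB S T)
  ... | no  ΔB-empty      = phase-tail-done inv ΔB-empty
  ... | yes (c₀ , c₀∈ΔB) with k
  ...   | zero   = contradiction ΔB≤k (<⇒≱ (x∈p⇒0<∣p∣ c₀∈ΔB))
  ...   | suc k′ = phase-tail-extend inv c∈ΔB φ l counted
    where
    open TailState inv
    L : List (Fin n)
    L = filter (SP._∈? ΔB S T) (allFin n)
    cands : List (Candidate S T)
    cands = candidates {S = S} phase prefix fuel L (λ c∈L → proj₂ (∈-filter⁻ (SP._∈? ΔB S T) {xs = allFin n} c∈L))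
    shortest : Candidate S T
    shortest = argmin (length ∘ visitOf) (candidate c₀ c₀∈ΔB (phase prefix (∈ΔB⇒Ready {S} {T} c₀∈ΔB) fuel)) cands
    open Candidate shortest renaming (center to c; new to c∈ΔB; phaseFrom to φ)
    ΔB′≤k′ : ∣ ΔB S (T ++ Phase.visit φ) ∣ ≤ k′
    ΔB′≤k′ = ≤-pred (<-≤-trans (≤-<-trans (p⊆q⇒∣p∣≤∣q∣ (ΔB-shrinks {S} φ)) (x∈p⇒∣p-x∣<∣p∣ c∈ΔB)) ΔB≤k)
    l : PhaseTail S w (T ++ Phase.visit φ)
    l = phase-tail phase k′ (state-extend inv c∈ΔB φ) (≤-trans fuel (+-monoˡ-≤ _ (length-++-≤ˡ T))) ΔB′≤k′
    centers : map Candidate.center cands ≡ L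
    centers = centers-candidates {S = S} phase prefix fuel L _
    -- The candidate phases are pairwise disjoint and all visited before the tail ends,
    -- so ∣ ΔB S T ∣ copies of the shortest one fit into it.
    counted : ∣ ΔB S T ∣ * length (Phase.visit φ) ≤ length (Phase.visit φ ++ PhaseTail.rest l)
    counted = candidates-length (prefix⇒PredClosed prefix) S⊆T (B-reassoc {T} (PhaseTail.closed l)) cands
      (subst Unique (sym centers) (filter⁺ (SP._∈? ΔB S T) (allFin⁺ n)))
      (λ v∈ΔB → subst (_ ∈_) (sym centers) (∈-filter⁺ (SP._∈? ΔB S T) (∈-allFin _) v∈ΔB))
      (f[argmin]≤f[xs] _ cands)

  phase-from-tail : ∀ {T c} → ReadySeq [] T → Ready T c → PhaseTail T c (T ++ [ c ]) → Phase T c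
  phase-from-tail {T} {c} pre rc l = record
    { visit     = c ∷ l.rest
    ; ready     = rc ∷ l.ready
    ; dominated = λ { (here refl) → dominates-self (prefix⇒PredClosed pre) rc ; (there y∈) → l.dominated y∈ }
    ; closed    = B-reassoc {T} {[ c ]} l.closed
    ; starts    = here refl
    ; bounded   = first ∷ l.bounded
    }
    where
    module l = PhaseTail l
    first : BoundaryWithin ∣ B T - c ∣ (suc (length l.rest)) (T ++ [ c ])
    first = within ∣ ΔB T (T ++ [ c ]) ∣ (leaf (∣ΔB∣≤d (initial-state pre rc)) (s≤s l.long))
                   (⊆∪⇒∣p∣≤∣q∣+∣r∣ (boundary-split {T} (∈-++⁺ʳ T (here refl))))

  phase : ∀ m → PhaseFrom m
  phase zero {T} {c} pre (c∉T , _) fuel =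
    contradiction (unique-length-≤n (¬Any⇒All¬ T c∉T AllPairs.∷ ReadySeq⇒Unique pre))
                  (<⇒≱ (s≤s (≤-trans fuel (≤-reflexive (+-identityʳ (length T))))))
  phase (suc m) {T} {c} pre rc fuel =
    phase-from-tail pre rc (phase-tail (phase m) n (initial-state pre rc) fuel′ (∣p∣≤n (ΔB T (T ++ [ c ]))))
    where
    fuel′ : n ≤ length (T ++ [ c ]) + m
    fuel′ = ≤-trans fuel (≤-reflexive (trans (sym (+-assoc (length T) 1 m)) (cong (_+ m) (sym (length-++ T)))))

module Visit {n : ℕ} (E : Graph n) (acyclic : Acyclic E) {d : ℕ} (outDeg≤d : ∀ v → ∣ sucSet E v ∣ ≤ d) where
  open Topological E
  open Phases E outDeg≤d
  open import Data.List.Membership.DecPropositional (_≟_ {n}) using (_∈?_)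

  ◅⇒Path : ∀ {u v w} → Edge u v → v ⇝ w → Path E u w
  ◅⇒Path u→v ε             = edge u→v
  ◅⇒Path u→v (v→a ◅ a⇝w) = step u→v (◅⇒Path v→a a⇝w)

  -- Walk backwards along unvisited predecessors; by acyclicity the walk never repeats a
  -- vertex, so it reaches a ready vertex within n steps.
  readyAncestor : ∀ m {T} x (xs : List (Fin n)) → x ∉ T → Unique (x ∷ xs) → All (x ⇝_) xs →
                  n ≤ length xs + m → ∃[ r ] Ready T r
  readyAncestor m {T} x xs x∉T uniq x⇝xs fuel with predsIn? T x
  ... | yes preds = x , x∉T , preds
  ... | no ¬preds with m | ¬predsIn⇒outsidePred ¬preds
  ...   | zero  | _             =
    contradiction (unique-length-≤n uniq) (<⇒≱ (s≤s (≤-trans fuel (≤-reflexive (+-identityʳ (length xs))))))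
  ...   | suc m | p , p→x , p∉T =
    readyAncestor m p (x ∷ xs) p∉T (All.map p≢ (ε ∷ x⇝xs) AllPairs.∷ uniq) (All.map (p→x ◅_) (ε ∷ x⇝xs))
                  (≤-trans fuel (≤-reflexive (+-suc (length xs) m)))
    where
    p≢ : ∀ {z} → x ⇝ z → ¬ p ≡ z
    p≢ x⇝p refl = acyclic p (◅⇒Path p→x x⇝p)

  unvisited⇒ready : ∀ {T v} → v ∉ T → ∃[ r ] Ready T r
  unvisited⇒ready v∉T = readyAncestor n _ [] v∉T ([] AllPairs.∷ AllPairs.[]) [] ≤-refl

  record Completion (T : List (Fin n)) : Set where
    field
      rest    : List (Fin n)
      ready   : ReadySeq T rest
      covers  : ∀ v → v ∈ T ++ rest
      bounded : AllPrefixes (BoundaryWithin 0 n) T rest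

  complete : ∀ m {T} → ReadySeq [] T → ∣ B T ∣ ≡ 0 → n ≤ length T + m → Completion T
  complete m {T} pre B≡0 fuel with any? (λ v → ¬? (v ∈? T))
  ... | no all-visited = record
    { rest    = []
    ; ready   = []
    ; covers  = λ v → subst (v ∈_) (sym (++-identityʳ T)) (visited v)
    ; bounded = []
    }
    where
    visited : ∀ v → v ∈ T
    visited v with v ∈? T
    ... | yes v∈T = v∈T
    ... | no  v∉T = contradiction (v , v∉T) all-visited
  ... | yes (v , v∉T) with m | unvisited⇒ready v∉T
  ...   | zero   | _ = contradiction (unique-length-≤n (¬Any⇒All¬ T v∉T AllPairs.∷ ReadySeq⇒Unique pre))
                                    (<⇒≱ (s≤s (≤-trans fuel (≤-reflexive (+-identityʳ (length T))))))
  ...   | suc m′ | r , r-ready = record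
    { rest    = φ.visit ++ c.rest
    ; ready   = Incremental-++ φ.visit φ.ready c.ready
    ; covers  = λ u → subst (u ∈_) (++-assoc T φ.visit c.rest) (c.covers u)
    ; bounded = Incremental-++ φ.visit (Incremental-map from-phase φ.bounded) c.bounded
    }
    where
    φ : Phase T r
    φ = phase n pre r-ready (m≤n+m n (length T))
    module φ = Phase φ
    pre′ : ReadySeq [] (T ++ φ.visit)
    pre′ = Incremental-++ T pre φ.ready
    fuel′ : n ≤ length (T ++ φ.visit) + m′
    fuel′ = begin
      n                              ≤⟨ fuel ⟩
      length T + suc m′              ≡⟨ +-suc (length T) m′ ⟩
      suc (length T) + m′            ≡⟨ cong (_+ m′) (+-comm 1 (length T)) ⟩
      length T + 1 + m′              ≤⟨ +-monoˡ-≤ m′ (+-monoʳ-≤ (length T) (∈-length φ.starts)) ⟩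
      length T + length φ.visit + m′ ≡⟨ cong (_+ m′) (length-++ T) ⟨
      length (T ++ φ.visit) + m′     ∎
      where open ≤-Reasoning
    c : Completion (T ++ φ.visit)
    c = complete m′ pre′ (n≤0⇒n≡0 (≤-trans (p⊆q⇒∣p∣≤∣q∣ φ.closed) (≤-reflexive B≡0))) fuel′
    module c = Completion c
    from-phase : ∀ {U} → BoundaryWithin ∣ B T - r ∣ (length φ.visit) U → BoundaryWithin 0 n U
    from-phase = within-weaken (≤-trans (∣p─q∣≤∣p∣ (B T) ⁅ r ⁆) (≤-reflexive B≡0))
                               (≤-trans (length-++-≤ʳ φ.visit {T}) (unique-length-≤n (ReadySeq⇒Unique pre′)))

module Construction {n : ℕ} (E : Graph n) (acyclic : Acyclic E) where
  open Topological E
  open Phases E (outDeg≤maxOutDeg)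
  open Visit E acyclic (outDeg≤maxOutDeg)

  B[]≡0 : ∣ B [] ∣ ≡ 0
  B[]≡0 = trans (cong ∣_∣ (Empty-unique λ (v , v∈B) → source-free (∈B⁻ {[]} v∈B))) (∣⊥∣≡0 n)
    where
    source-free : ∀ {v} → ¬ InBoundary [] v
    source-free ((_ , preds) , u , u→v) with () ← preds u u→v

  order : Completion []
  order = complete n [] B[]≡0 ≤-refl

  ψ : List (Fin n)
  ψ = Completion.rest order

  ψ-ready : ReadySeq [] ψ
  ψ-ready = Completion.ready order

  ψ-covers : ∀ v → v ∈ ψ
  ψ-covers = Completion.covers order

  prefix-bound : ∀ {i} → i < length ψ → BoundaryWithin 0 n (take (suc i) ψ)
  prefix-bound = AllPrefixes-take {P = BoundaryWithin 0 n} (Completion.bounded order)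

  bnum≤maxOutDeg : maxOutDeg E ≤ 1 → bnum (rTop E) ψ ≤ maxOutDeg E
  bnum≤maxOutDeg d≤1 = bnum-elim (_≤ maxOutDeg E) {ψ} z≤n λ i<ψ →
    let within x ex B≤x = prefix-bound i<ψ in ≤-trans B≤x (Excess⇒≤d d≤1 ex)

  bnum-bound : ∀ D → 2 ≤ D → maxOutDeg E ≤ D → bnum (rTop E) ψ ≡ 0 ⊎ D ^ (bnum (rTop E) ψ ∸ 1) ≤ n ^ (D ∸ 1)
  bnum-bound D@(suc _) _ d≤D = bnum-elim (λ b → b ≡ 0 ⊎ D ^ (b ∸ 1) ≤ n ^ (D ∸ 1)) {ψ} (inj₁ refl) λ i<ψ →
    let within x ex B≤x = prefix-bound i<ψ
    in inj₂ (≤-trans (^-monoʳ-≤ D (∸-monoˡ-≤ 1 B≤x)) (Excess⇒D^x≤s^D d≤D ex))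

theorem16 : (n : ℕ) (E : Graph n) → Acyclic E →
    Σ (List (Fin n)) λ ψ →
      IsRVisit (rTop E) ψ ×
      (maxOutDeg E ≡ 0 → bnum (rTop E) ψ ≡ 0) ×
      (maxOutDeg E ≡ 1 → bnum (rTop E) ψ ≡ 1) ×
      ((D : ℕ) → 2 ≤ D → maxOutDeg E ≤ D →
        bnum (rTop E) ψ ≡ 0 ⊎ D ^ (bnum (rTop E) ψ ∸ 1) ≤ n ^ (D ∸ 1))
theorem16 n E acyclic =
  ψ , ReadySeq⇒IsRVisit ψ-ready ψ-covers , no-edges , out-degree-one , bnum-bound
  where
  open Construction E acyclic
  open Topological E
  no-edges : maxOutDeg E ≡ 0 → bnum (rTop E) ψ ≡ 0
  no-edges d≡0 = n≤0⇒n≡0 (subst (bnum (rTop E) ψ ≤_) d≡0 (bnum≤maxOutDeg (≤-trans (≤-reflexive d≡0) z≤n)))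
  out-degree-one : maxOutDeg E ≡ 1 → bnum (rTop E) ψ ≡ 1
  out-degree-one d≡1 with v , u , v→u ← 0<maxOutDeg⇒edge (≤-reflexive (sym d≡1)) =
    ≤-antisym (subst (bnum (rTop E) ψ ≤_) d≡1 (bnum≤maxOutDeg (≤-reflexive d≡1)))
              (edge⇒1≤bnum ψ-ready (ψ-covers u) v→u)
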